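{- Let $G$ be a connected graph of order $n$. If $\dim(G)=n-4$, $\mathrm{diam}(G)=3$ and $|V(G^{\ast})|=4$, then $D(G)\neq n-3$.
   Context: $\dim(G)$ is the metric dimension (minimum size of a set $S\subseteq V(G)$ such that every two distinct vertices have different distances to some vertex of $S$); $D(G)$ is the distinguishing number (minimum number of colours in a not necessarily proper vertex colouring preserved by no non-trivial automorphism). Two vertices $u\neq v$ are twins if $N(v)\setminus\{u\}=N(u)\setminus\{v\}$ (equal open or equal closed neighbourhoods); the classes of the equivalence relation "$u=v$ or $u,v$ twins" are denoted $v^{\ast}$, and the twin graph $G^{\ast}$ has these classes as vertices, with $u^{\ast}v^{\ast}$ an edge iff $uv\in E(G)$. -}

module Defs where

open import Data.Nat using (ℕ; zero; suc; _<_; _≤_)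
open import Data.Fin using (Fin)
open import Data.Fin.Subset using (Subset; _∈_; ∣_∣)
open import Data.Fin.Permutation using (Permutation′; _⟨$⟩ʳ_)
open import Data.Bool using (Bool; true; false)
open import Data.Product using (Σ; ∃; ∃-syntax; _×_; _,_)
open import Data.Sum using (_⊎_)
open import Relation.Binary.PropositionalEquality using (_≡_; _≢_)
open import Relation.Nullary using (¬_)

record Graph (n : ℕ) : Set where
  field
    adj     : Fin n → Fin n → Bool
    adj-sym : ∀ u v → adj u v ≡ adj v u
    adj-irr : ∀ v → adj v v ≡ false
open Graph public

module _ {n : ℕ} (G : Graph n) where

  data Walk : Fin n → Fin n → ℕ → Set where
    nil  : ∀ {u} → Walk u u zero
    cons : ∀ {u w v k} → adj G u w ≡ true → Walk w v k → Walk u (v) (suc k)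

  Connected : Set
  Connected = ∀ u v → ∃[ k ] Walk u v k

  IsDist : Fin n → Fin n → ℕ → Set
  IsDist u v d = Walk u v d × (∀ k → k < d → ¬ Walk u v k)

  HasDiameter : ℕ → Set
  HasDiameter d =
    (∀ u v → ∃[ e ] (IsDist u v e × e ≤ d)) × (∃[ u ] ∃[ v ] IsDist u v d)

  Resolving : Subset n → Set
  Resolving S = ∀ u v → u ≢ v →
    ∃[ s ] (s ∈ S × ∃[ d₁ ] ∃[ d₂ ] (IsDist s u d₁ × IsDist s v d₂ × d₁ ≢ d₂))

  HasMetricDim : ℕ → Set
  HasMetricDim m =
    (∃[ S ] (Resolving S × ∣ S ∣ ≡ m)) × (∀ S → Resolving S → m ≤ ∣ S ∣)

  IsAutomorphism : Permutation′ n → Set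
  IsAutomorphism π = ∀ u v → adj G (π ⟨$⟩ʳ u) (π ⟨$⟩ʳ v) ≡ adj G u v

  Distinguishing : (k : ℕ) → (Fin n → Fin k) → Set
  Distinguishing k c = ∀ π → IsAutomorphism π →
    (∀ v → c (π ⟨$⟩ʳ v) ≡ c v) → ∀ v → π ⟨$⟩ʳ v ≡ v

  HasDistNum : ℕ → Set
  HasDistNum k =
    (∃[ c ] Distinguishing k c) × (∀ j (c : Fin n → Fin j) → Distinguishing j c → k ≤ j)

  Twins : Fin n → Fin n → Set
  Twins u v = u ≢ v × (∀ w → w ≢ u → w ≢ v → adj G u w ≡ adj G v w)

  -- the twin graph G* has exactly m vertices: the relation "u = v or twins"
  -- has exactly m classes, given by a surjective class map
  TwinClassCount : ℕ → Set
  TwinClassCount m = Σ (Fin n → Fin m) λ cls →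
    (∀ u v → cls u ≡ cls v → (u ≡ v ⊎ Twins u v)) ×
    (∀ u v → (u ≡ v ⊎ Twins u v) → cls u ≡ cls v) ×
    (∀ i → ∃[ v ] cls v ≡ i)

-- A resolving set contains one of any two twins, so each of the four twin classes has exactly
-- one vertex r i outside a metric basis S of size n − 4. Give the vertices of S distinct colours
-- and give r i the colour of a vertex g i ∈ S of another class h i. A colour-preserving
-- automorphism that moves some s ∈ S sends s to r (h k) and r k to g k, where k is the class of s,
-- so h (h k) = k. If S meets three classes, h can be chosen without 2-cycles. If S meets exactly
-- two classes a and b, the automorphism swaps r j with g j for j ∈ {a, b} and fixes the other two
-- vertices, which then see all or nothing of the classes a and b; connectivity makes the diameter 2.
-- If S lies in one class, it cannot separate the r i, whose distances to S lie in {1, 2, 3}.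
-- Hence n − 4 colours suffice and D(G) ≤ n − 4.

module Submission where

open import Defs
open import Data.Bool using (true; false)
open import Data.Empty using (⊥; ⊥-elim)
open import Data.Fin using (Fin; zero; suc; fromℕ<; toℕ; join; splitAt; punchOut)
open import Data.Fin.Patterns using (0F; 1F; 2F; 3F)
open import Data.Fin.Permutation using (Permutation′; _⟨$⟩ʳ_; _⟨$⟩ˡ_; inverseˡ; inverseʳ)
open import Data.Fin.Properties
  using ( _≟_; suc-injective; all?; any?; pigeonhole; injective⇒≤; <⇒≢; toℕ-fromℕ<; splitAt-join
        ; punchOut-injective; 0≢1+n)
open import Data.Fin.Subset using (Subset; _∈_; _∉_; ∣_∣; inside; outside)
open import Data.Fin.Subset.Properties using (_∈?_)
open import Data.Nat using (ℕ; zero; suc; pred; _+_; _∸_; _≤_; _<_; z≤n; s≤s)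
open import Data.Nat.Properties using (≤-antisym; ≮⇒≥; ≤-refl; ≤-trans; n≤1+n; n<1+n; <⇒≱; +-comm)
open import Data.Product using (∃-syntax; ∃₂; _×_; _,_; proj₁; proj₂; uncurry)
open import Data.Sum using (_⊎_; inj₁; inj₂; [_,_]′)
open import Data.Sum.Properties using (inj₁-injective; inj₂-injective)
open import Data.Vec using (_∷_; here; there)
open import Data.Vec.Functional using (updateAt)
open import Data.Vec.Functional.Properties using (updateAt-updates; updateAt-minimal)
open import Function using (_∘_; const)
open import Relation.Nullary using (¬_; Dec; yes; no; contradiction)
open import Relation.Nullary.Decidable using (map′; ¬?; _×-dec_; _⊎-dec_; from-yes; decidable-stable)
open import Relation.Binary.PropositionalEquality

∈-∉-distinct : ∀ {n} {S : Subset n} {u v} → u ∈ S → v ∉ S → u ≢ v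
∈-∉-distinct u∈S v∉S refl = v∉S u∈S

module _ {n : ℕ} (G : Graph n) where

  Adj : Fin n → Fin n → Set
  Adj u v = adj G u v ≡ true

  Adj-sym : ∀ {u v} → Adj u v → Adj v u
  Adj-sym {u} {v} = trans (adj-sym G v u)

  Adj-irrefl : ∀ {u v} → Adj u v → u ≢ v
  Adj-irrefl {u} uv refl with trans (sym uv) (adj-irr G u)
  ... | ()

  walk-zero : ∀ {u v} → Walk G u v 0 → u ≡ v
  walk-zero nil = refl

  walk-snoc : ∀ {u v w k} → Walk G u v k → Adj v w → Walk G u w (suc k)
  walk-snoc nil         vw = cons vw nil
  walk-snoc (cons uz p) vw = cons uz (walk-snoc p vw)

  walk-reverse : ∀ {u v k} → Walk G u v k → Walk G v u k
  walk-reverse nil         = nil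
  walk-reverse (cons uz p) = walk-snoc (walk-reverse p) (Adj-sym uz)

  walk-closed : (P : Fin n → Set) → (∀ {u v} → P u → Adj u v → P v) →
                ∀ {u v k} → Walk G u v k → P u → P v
  walk-closed P closed nil         pu = pu
  walk-closed P closed (cons uz p) pu = walk-closed P closed p (closed pu uz)

  IsDist-≤ : ∀ {u v d k} → IsDist G u v d → Walk G u v k → d ≤ k
  IsDist-≤ (_ , minimal) p = ≮⇒≥ λ k<d → minimal _ k<d p

  IsDist-functional : ∀ {u v d d′} → IsDist G u v d → IsDist G u v d′ → d ≡ d′
  IsDist-functional D D′ = ≤-antisym (IsDist-≤ D (proj₁ D′)) (IsDist-≤ D′ (proj₁ D))

  IsDist-sym : ∀ {u v d} → IsDist G u v d → IsDist G v u d
  IsDist-sym (p , minimal) = walk-reverse p , λ k k<d q → minimal k k<d (walk-reverse q)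

  IsDist-nonzero : ∀ {u v d} → IsDist G u v d → u ≢ v → d ≢ 0
  IsDist-nonzero (p , _) u≢v refl = u≢v (walk-zero p)

  Near : Fin n → Fin n → Set
  Near u v = u ≡ v ⊎ Adj u v

  Within2 : Fin n → Fin n → Set
  Within2 u v = ∃[ z ] (Near u z × Near z v)

  Within2⇒IsDist≤2 : ∀ {u v d} → Within2 u v → IsDist G u v d → d ≤ 2
  Within2⇒IsDist≤2 (_ , inj₁ refl , inj₁ refl) D = ≤-trans (IsDist-≤ D nil) z≤n
  Within2⇒IsDist≤2 (_ , inj₁ refl , inj₂ zv)   D = ≤-trans (IsDist-≤ D (cons zv nil)) (s≤s z≤n)
  Within2⇒IsDist≤2 (_ , inj₂ uz   , inj₁ refl) D = ≤-trans (IsDist-≤ D (cons uz nil)) (s≤s z≤n)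
  Within2⇒IsDist≤2 (_ , inj₂ uz   , inj₂ zv)   D = IsDist-≤ D (cons uz (cons zv nil))

  TwinOrEqual : Fin n → Fin n → Set
  TwinOrEqual u v = u ≡ v ⊎ Twins G u v

  Twins-sym : ∀ {u v} → Twins G u v → Twins G v u
  Twins-sym (u≢v , same) = (λ e → u≢v (sym e)) , λ w w≢v w≢u → sym (same w w≢u w≢v)

  twins-adj : ∀ {u v w} → Twins G u v → w ≢ u → w ≢ v → adj G w u ≡ adj G w v
  twins-adj {u} {v} {w} (_ , same) w≢u w≢v = begin
    adj G w u ≡⟨ adj-sym G w u ⟩
    adj G u w ≡⟨ same w w≢u w≢v ⟩
    adj G v w ≡⟨ adj-sym G v w ⟩
    adj G w v ∎
    where open ≡-Reasoning

  twin-or-equal-adj : ∀ {u v w} → TwinOrEqual u v → w ≢ u → w ≢ v → adj G w u ≡ adj G w v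
  twin-or-equal-adj (inj₁ refl) _ _ = refl
  twin-or-equal-adj (inj₂ uv)   w≢u w≢v = twins-adj uv w≢u w≢v

  twins-walk : ∀ {u v w k} → Twins G u v → w ≢ u → w ≢ v → Walk G u w k →
               ∃[ k′ ] (k′ ≤ k × Walk G v w k′)
  twins-walk _ w≢u _ nil = ⊥-elim (w≢u refl)
  twins-walk {u} {v} {k = suc k} (u≢v , same) w≢u w≢v (cons {w = z} uz p) with z ≟ v
  ... | yes refl = k , n≤1+n k , p
  ... | no z≢v   = suc k , ≤-refl , cons (trans (sym (same z (λ z≡u → Adj-irrefl uz (sym z≡u)) z≢v)) uz) p

  twins-equidistant : ∀ {u v w d d′} → Twins G u v → w ≢ u → w ≢ v →
                      IsDist G u w d → IsDist G v w d′ → d ≡ d′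
  twins-equidistant uv w≢u w≢v D D′ =
    ≤-antisym (shorter (Twins-sym uv) w≢v w≢u D′ D) (shorter uv w≢u w≢v D D′)
    where
    shorter : ∀ {u v w d d′} → Twins G u v → w ≢ u → w ≢ v →
              IsDist G u w d → IsDist G v w d′ → d′ ≤ d
    shorter uv w≢u w≢v (p , _) D′ with twins-walk uv w≢u w≢v p
    ... | _ , k′≤k , q = ≤-trans (IsDist-≤ D′ q) k′≤k

  twin-or-equal-equidistant : ∀ {u v w d d′} → TwinOrEqual u v → w ≢ u → w ≢ v →
                              IsDist G u w d → IsDist G v w d′ → d ≡ d′
  twin-or-equal-equidistant (inj₁ refl) _   _   D D′ = IsDist-functional D D′
  twin-or-equal-equidistant (inj₂ uv)   w≢u w≢v D D′ = twins-equidistant uv w≢u w≢v D D′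

  resolving-meets-twins : ∀ {S u v} → Resolving G S → Twins G u v → u ∉ S → v ∉ S → ⊥
  resolving-meets-twins res uv u∉S v∉S with res _ _ (proj₁ uv)
  ... | s , s∈S , _ , _ , D₁ , D₂ , d₁≢d₂ =
    d₁≢d₂ (twins-equidistant uv (∈-∉-distinct s∈S u∉S) (∈-∉-distinct s∈S v∉S)
                             (IsDist-sym D₁) (IsDist-sym D₂))

  walk-map : (f : Fin n → Fin n) → (∀ u v → adj G (f u) (f v) ≡ adj G u v) →
             ∀ {u v k} → Walk G u v k → Walk G (f u) (f v) k
  walk-map f hom nil                = nil
  walk-map f hom (cons {u} {z} uz p) = cons (trans (hom u z) uz) (walk-map f hom p)

  module Automorphism (π : Permutation′ n) (aut : IsAutomorphism G π) where

    injective : ∀ {u v} → π ⟨$⟩ʳ u ≡ π ⟨$⟩ʳ v → u ≡ v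
    injective {u} {v} eq = trans (sym (inverseˡ π)) (trans (cong (π ⟨$⟩ˡ_) eq) (inverseˡ π))

    inverse-aut : ∀ u v → adj G (π ⟨$⟩ˡ u) (π ⟨$⟩ˡ v) ≡ adj G u v
    inverse-aut u v = trans (sym (aut _ _)) (cong₂ (adj G) (inverseʳ π) (inverseʳ π))

    walk-unmap : ∀ {u v k} → Walk G (π ⟨$⟩ʳ u) (π ⟨$⟩ʳ v) k → Walk G u v k
    walk-unmap p =
      subst₂ (λ a b → Walk G a b _) (inverseˡ π) (inverseˡ π) (walk-map (π ⟨$⟩ˡ_) inverse-aut p)

    IsDist-map : ∀ {u v d} → IsDist G u v d → IsDist G (π ⟨$⟩ʳ u) (π ⟨$⟩ʳ v) d
    IsDist-map (p , minimal) = walk-map (π ⟨$⟩ʳ_) aut p , λ k k<d q → minimal k k<d (walk-unmap q)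

    Twins-map : ∀ {u v} → Twins G u v → Twins G (π ⟨$⟩ʳ u) (π ⟨$⟩ʳ v)
    Twins-map {u} {v} (u≢v , same) = (λ eq → u≢v (injective eq)) , λ w w≢πu w≢πv →
      let w′ = π ⟨$⟩ˡ w
          w′≢ : ∀ {x} → w ≢ π ⟨$⟩ʳ x → w′ ≢ x
          w′≢ w≢πx w′≡x = w≢πx (trans (sym (inverseʳ π)) (cong (π ⟨$⟩ʳ_) w′≡x))
      in begin
        adj G (π ⟨$⟩ʳ u) w       ≡⟨ cong (adj G _) (sym (inverseʳ π)) ⟩
        adj G (π ⟨$⟩ʳ u) (π ⟨$⟩ʳ w′) ≡⟨ aut u w′ ⟩
        adj G u w′               ≡⟨ same w′ (w′≢ w≢πu) (w′≢ w≢πv) ⟩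
        adj G v w′               ≡⟨ sym (aut v w′) ⟩
        adj G (π ⟨$⟩ʳ v) (π ⟨$⟩ʳ w′) ≡⟨ cong (adj G _) (inverseʳ π) ⟩
        adj G (π ⟨$⟩ʳ v) w       ∎
      where open ≡-Reasoning

    TwinOrEqual-map : ∀ {u v} → TwinOrEqual u v → TwinOrEqual (π ⟨$⟩ʳ u) (π ⟨$⟩ʳ v)
    TwinOrEqual-map (inj₁ refl) = inj₁ refl
    TwinOrEqual-map (inj₂ uv)   = inj₂ (Twins-map uv)

    fixing-resolving⇒identity : ∀ {S} → Resolving G S → (∀ s → s ∈ S → π ⟨$⟩ʳ s ≡ s) →
                                ∀ v → π ⟨$⟩ʳ v ≡ v
    fixing-resolving⇒identity res fixes v with π ⟨$⟩ʳ v ≟ v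
    ... | yes fixed = fixed
    ... | no moved with res _ _ moved
    ... | s , s∈S , _ , _ , D₁ , D₂ , d₁≢d₂ =
      ⊥-elim (d₁≢d₂ (IsDist-functional D₁ (subst (λ x → IsDist G x _ _) (fixes s s∈S) (IsDist-map D₂))))

  Near-sym : ∀ {u v} → Near u v → Near v u
  Near-sym (inj₁ refl) = inj₁ refl
  Near-sym (inj₂ uv)   = inj₂ (Adj-sym uv)

  HomogeneousTo : (Fin n → Set) → Fin n → Set
  HomogeneousTo C w = ∀ {u v} → C u → C v → adj G w u ≡ adj G w v

  hub-within2 : Connected G → (C : Fin n → Set) → ∀ {c} → C c → (H O : Fin n) → H ≢ O →
                (∀ v → C v ⊎ v ≡ H ⊎ v ≡ O) → (∀ {v} → C v → Adj H v) → HomogeneousTo C O →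
                ∀ u v → Within2 u v
  hub-within2 conn C {c} c∈C H O H≢O cover H-dominates O-homogeneous u v with adj G H O in HO
  ... | true = H , Near-sym (H-near u) , H-near v
    where
    H-near : ∀ v → Near H v
    H-near v with cover v
    ... | inj₁ v∈C         = inj₂ (H-dominates v∈C)
    ... | inj₂ (inj₁ refl) = inj₁ refl
    ... | inj₂ (inj₂ refl) = inj₂ HO
  ... | false = go (cover u) (cover v)
    where
    -- O has a neighbour because G is connected, and it can only lie in C.
    O-c : Adj O c
    O-c with adj G O c in Oc
    ... | true  = refl
    ... | false = ⊥-elim (H≢O (walk-closed (_≡ O) stuck (proj₂ (conn O H)) refl))
      where
      stuck : ∀ {w v} → w ≡ O → Adj w v → v ≡ O
      stuck {v = v} refl Ov with cover v
      ... | inj₁ v∈C         with () ← trans (sym Ov) (trans (O-homogeneous v∈C c∈C) Oc)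
      ... | inj₂ (inj₁ refl) with () ← trans (sym (Adj-sym Ov)) HO
      ... | inj₂ (inj₂ refl) = refl
    O-dominates : ∀ {v} → C v → Adj O v
    O-dominates v∈C = trans (O-homogeneous v∈C c∈C) O-c
    go : ∀ {u v} → C u ⊎ u ≡ H ⊎ u ≡ O → C v ⊎ v ≡ H ⊎ v ≡ O → Within2 u v
    go (inj₁ u∈C)        (inj₁ v∈C)        = H , inj₂ (Adj-sym (H-dominates u∈C)) , inj₂ (H-dominates v∈C)
    go (inj₁ u∈C)        (inj₂ (inj₁ refl)) = H , inj₂ (Adj-sym (H-dominates u∈C)) , inj₁ refl
    go (inj₁ u∈C)        (inj₂ (inj₂ refl)) = O , inj₂ (Adj-sym (O-dominates u∈C)) , inj₁ refl
    go (inj₂ (inj₁ refl)) (inj₁ v∈C)        = H , inj₁ refl , inj₂ (H-dominates v∈C)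
    go (inj₂ (inj₁ refl)) (inj₂ (inj₁ refl)) = H , inj₁ refl , inj₁ refl
    go (inj₂ (inj₁ refl)) (inj₂ (inj₂ refl)) = c , inj₂ (H-dominates c∈C) , inj₂ (Adj-sym O-c)
    go (inj₂ (inj₂ refl)) (inj₁ v∈C)        = O , inj₁ refl , inj₂ (O-dominates v∈C)
    go (inj₂ (inj₂ refl)) (inj₂ (inj₁ refl)) = c , inj₂ O-c , inj₂ (Adj-sym (H-dominates c∈C))
    go (inj₂ (inj₂ refl)) (inj₂ (inj₂ refl)) = O , inj₁ refl , inj₁ refl

  -- C is a module of G (every outside vertex sees all of C or none of it) with exactly two
  -- vertices outside; connectivity forces one of them to see all of C.
  module-with-two-outside-within2 :
    Connected G → (C : Fin n → Set) → ∀ {c} → C c → (R W : Fin n) → R ≢ W → ¬ C R → ¬ C W →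
    (∀ v → C v ⊎ v ≡ R ⊎ v ≡ W) → HomogeneousTo C R → HomogeneousTo C W → ∀ u v → Within2 u v
  module-with-two-outside-within2 conn C {c} c∈C R W R≢W R∉C W∉C cover R-hom W-hom
    with adj G R c in Rc | adj G W c in Wc
  ... | true  | _    = hub-within2 conn C c∈C R W R≢W cover (λ v∈C → trans (R-hom v∈C c∈C) Rc) W-hom
  ... | false | true =
    hub-within2 conn C c∈C W R (R≢W ∘ sym) swapped (λ v∈C → trans (W-hom v∈C c∈C) Wc) R-hom
    where
    swapped : ∀ v → C v ⊎ v ≡ W ⊎ v ≡ R
    swapped v = [ inj₁ , (λ v∈RW → inj₂ ([ inj₂ , inj₁ ]′ v∈RW)) ]′ (cover v)
  ... | false | false =
    ⊥-elim ([ (λ c≡R → R∉C (subst C c≡R c∈C)) , (λ c≡W → W∉C (subst C c≡W c∈C)) ]′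
              (walk-closed (λ w → w ≡ R ⊎ w ≡ W) stuck (proj₂ (conn R c)) (inj₁ refl)))
    where
    stuck : ∀ {w v} → w ≡ R ⊎ w ≡ W → Adj w v → v ≡ R ⊎ v ≡ W
    stuck {v = v} w∈RW wv with cover v
    ... | inj₂ v∈RW = v∈RW
    stuck (inj₁ refl) Rv | inj₁ v∈C with () ← trans (sym Rv) (trans (R-hom v∈C c∈C) Rc)
    stuck (inj₂ refl) Wv | inj₁ v∈C with () ← trans (sym Wv) (trans (W-hom v∈C c∈C) Wc)

index : ∀ {n} (p : Subset n) {v} → v ∈ p → Fin ∣ p ∣
index (inside ∷ p)  here        = zero
index (inside ∷ p)  (there v∈p) = suc (index p v∈p)
index (outside ∷ p) (there v∈p) = index p v∈p

index-injective : ∀ {n} (p : Subset n) {u v} (u∈p : u ∈ p) (v∈p : v ∈ p) →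
                  index p u∈p ≡ index p v∈p → u ≡ v
index-injective (inside ∷ p)  here        here        _  = refl
index-injective (inside ∷ p)  (there u∈p) (there v∈p) eq =
  cong suc (index-injective p u∈p v∈p (suc-injective eq))
index-injective (outside ∷ p) (there u∈p) (there v∈p) eq = cong suc (index-injective p u∈p v∈p eq)

-- Together with an injection of the complement of p into Fin k, index embeds Fin n into Fin (∣ p ∣ + k).
∣∁∣-injection⇒≤ : ∀ {n k} (p : Subset n) (f : ∀ v → v ∉ p → Fin k) →
                  (∀ {u v} (u∉p : u ∉ p) (v∉p : v ∉ p) → f u u∉p ≡ f v v∉p → u ≡ v) →
                  n ≤ ∣ p ∣ + k
∣∁∣-injection⇒≤ {n} {k} p f f-injective = injective⇒≤ {f = λ v → join ∣ p ∣ k (embed v)} λ eq →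
  embed-injective (trans (sym (splitAt-join ∣ p ∣ k _))
                  (trans (cong (splitAt ∣ p ∣) eq) (splitAt-join ∣ p ∣ k _)))
  where
  embed : Fin n → Fin ∣ p ∣ ⊎ Fin k
  embed v with v ∈? p
  ... | yes v∈p = inj₁ (index p v∈p)
  ... | no  v∉p = inj₂ (f v v∉p)
  embed-injective : ∀ {u v} → embed u ≡ embed v → u ≡ v
  embed-injective {u} {v} eq with u ∈? p | v ∈? p
  ... | yes u∈p | yes v∈p = index-injective p u∈p v∈p (inj₁-injective eq)
  ... | no  u∉p | no  v∉p = f-injective u∉p v∉p (inj₂-injective eq)

record Complement (a b x y : Fin 4) : Set where
  field
    x≢a : x ≢ a
    x≢b : x ≢ b
    y≢a : y ≢ a
    y≢b : y ≢ b
    x≢y : x ≢ y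
    cover : ∀ j → j ≡ a ⊎ j ≡ b ⊎ j ≡ x ⊎ j ≡ y

complement? : ∀ a b x y → Dec (Complement a b x y)
complement? a b x y =
  map′ (λ (x≢a , x≢b , y≢a , y≢b , x≢y , cover) → record
         { x≢a = x≢a ; x≢b = x≢b ; y≢a = y≢a ; y≢b = y≢b ; x≢y = x≢y ; cover = cover })
       (λ c → let open Complement c in x≢a , x≢b , y≢a , y≢b , x≢y , cover)
       (¬? (x ≟ a) ×-dec ¬? (x ≟ b) ×-dec ¬? (y ≟ a) ×-dec ¬? (y ≟ b) ×-dec ¬? (x ≟ y) ×-dec
        all? (λ j → j ≟ a ⊎-dec j ≟ b ⊎-dec j ≟ x ⊎-dec j ≟ y))

complete-pair : ∀ {a b} → a ≢ b → ∃₂ λ x y → Complement a b x y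
complete-pair {0F} {1F} _ = 2F , 3F , from-yes (complement? 0F 1F 2F 3F)
complete-pair {0F} {2F} _ = 1F , 3F , from-yes (complement? 0F 2F 1F 3F)
complete-pair {0F} {3F} _ = 1F , 2F , from-yes (complement? 0F 3F 1F 2F)
complete-pair {1F} {0F} _ = 2F , 3F , from-yes (complement? 1F 0F 2F 3F)
complete-pair {1F} {2F} _ = 0F , 3F , from-yes (complement? 1F 2F 0F 3F)
complete-pair {1F} {3F} _ = 0F , 2F , from-yes (complement? 1F 3F 0F 2F)
complete-pair {2F} {0F} _ = 1F , 3F , from-yes (complement? 2F 0F 1F 3F)
complete-pair {2F} {1F} _ = 0F , 3F , from-yes (complement? 2F 1F 0F 3F)
complete-pair {2F} {3F} _ = 0F , 1F , from-yes (complement? 2F 3F 0F 1F)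
complete-pair {3F} {0F} _ = 1F , 2F , from-yes (complement? 3F 0F 1F 2F)
complete-pair {3F} {1F} _ = 0F , 2F , from-yes (complement? 3F 1F 0F 2F)
complete-pair {3F} {2F} _ = 0F , 1F , from-yes (complement? 3F 2F 0F 1F)
complete-pair {0F} {0F} a≢b = contradiction refl a≢b
complete-pair {1F} {1F} a≢b = contradiction refl a≢b
complete-pair {2F} {2F} a≢b = contradiction refl a≢b
complete-pair {3F} {3F} a≢b = contradiction refl a≢b

private
  pred< : ∀ {k m} → k ≢ 0 → k ≤ m → pred k < m
  pred< {zero}  k≢0 _   = contradiction refl k≢0
  pred< {suc k} _   k≤m = k≤m

  pred-injective : ∀ {k l} → k ≢ 0 → l ≢ 0 → pred k ≡ pred l → k ≡ l
  pred-injective {zero}          k≢0 _   _  = contradiction refl k≢0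
  pred-injective {suc _} {zero}  _   l≢0 _  = contradiction refl l≢0
  pred-injective {suc _} {suc _} _   _   eq = cong suc eq

pigeonhole-positive : ∀ {m n} → m < n → (d : Fin n → ℕ) → (∀ i → d i ≢ 0) → (∀ i → d i ≤ m) →
                      ∃₂ λ i j → i ≢ j × d i ≡ d j
pigeonhole-positive m<n d d≢0 d≤m
  with i , j , i<j , eq ← pigeonhole m<n (λ i → fromℕ< (pred< (d≢0 i) (d≤m i)))
  = i , j , <⇒≢ i<j ,
    pred-injective (d≢0 i) (d≢0 j) (trans (sym (toℕ-fromℕ< _)) (trans (cong toℕ eq) (toℕ-fromℕ< _)))

module TwoPoint {m : ℕ} (a b p q : Fin m) where

  twoPoint : Fin m → Fin m
  twoPoint = updateAt (updateAt (const a) p (const q)) a (const b)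

  at-a : twoPoint a ≡ b
  at-a = updateAt-updates a _

  at-p : p ≢ a → twoPoint p ≡ q
  at-p p≢a = trans (updateAt-minimal p a _ p≢a) (updateAt-updates p (const a))

  elsewhere : ∀ {j} → j ≢ a → j ≢ p → twoPoint j ≡ a
  elsewhere j≢a j≢p = trans (updateAt-minimal _ a _ j≢a) (updateAt-minimal _ p (const a) j≢p)

  closed : ∀ {ℓ} (P : Fin m → Set ℓ) → P a → P b → P q → ∀ j → P (twoPoint j)
  closed P Pa Pb Pq j with j ≟ a
  ... | yes refl = subst P (sym at-a) Pb
  ... | no  j≢a with j ≟ p
  ...   | yes refl = subst P (sym (at-p j≢a)) Pq
  ...   | no  j≢p  = subst P (sym (elsewhere j≢a j≢p)) Pa

module _ {m : ℕ} {a b c : Fin m} (b≢a : b ≢ a) (c≢a : c ≢ a) (c≢b : c ≢ b) where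
  open TwoPoint a b b c
  open ≡-Reasoning

  -- twoPoint is the 3-cycle (a b c) on {a, b, c} and sends every other point to a.
  twoPoint-no-2-cycle : ∀ j → twoPoint (twoPoint j) ≢ j
  twoPoint-no-2-cycle j with j ≟ a | j ≟ b
  ... | yes refl | _        = λ ffa≡a → c≢a (begin
    c                     ≡⟨ at-p b≢a ⟨
    twoPoint b            ≡⟨ cong twoPoint at-a ⟨
    twoPoint (twoPoint a) ≡⟨ ffa≡a ⟩
    a                     ∎)
  ... | no  _    | yes refl = λ ffb≡b → b≢a (begin
    b                     ≡⟨ ffb≡b ⟨
    twoPoint (twoPoint b) ≡⟨ cong twoPoint (at-p b≢a) ⟩
    twoPoint c            ≡⟨ elsewhere c≢a c≢b ⟩
    a                     ∎)
  ... | no  j≢a  | no  j≢b  = λ ffj≡j → j≢b (begin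
    j                     ≡⟨ ffj≡j ⟨
    twoPoint (twoPoint j) ≡⟨ cong twoPoint (elsewhere j≢a j≢b) ⟩
    twoPoint a            ≡⟨ at-a ⟩
    b                     ∎)

n∸4+3<n : ∀ {n} → 4 ≤ n → n ∸ 4 + 3 < n
n∸4+3<n {suc (suc (suc (suc m)))} (s≤s (s≤s (s≤s (s≤s _)))) = subst (_< 4 + m) (+-comm 3 m) (n<1+n (3 + m))

n∸4<n∸3 : ∀ {n} → 4 ≤ n → n ∸ 4 < n ∸ 3
n∸4<n∸3 (s≤s (s≤s (s≤s (s≤s _)))) = ≤-refl

module Hypotheses {n : ℕ} (G : Graph n) (conn : Connected G) (diam : HasDiameter G 3)
  {S : Subset n} (resolving : Resolving G S) (∣S∣≡ : ∣ S ∣ ≡ n ∸ 4)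
  (cls : Fin n → Fin 4)
  (cls-sound : ∀ u v → cls u ≡ cls v → TwinOrEqual G u v)
  (cls-complete : ∀ u v → TwinOrEqual G u v → cls u ≡ cls v)
  (cls-onto : ∀ i → ∃[ v ] cls v ≡ i) where

  4≤n : 4 ≤ n
  4≤n = injective⇒≤ {f = λ i → proj₁ (cls-onto i)} λ {i} {j} eq →
    trans (sym (proj₂ (cls-onto i))) (trans (cong cls eq) (proj₂ (cls-onto j)))

  ∉S-cls-injective : ∀ {u v} → u ∉ S → v ∉ S → cls u ≡ cls v → u ≡ v
  ∉S-cls-injective u∉S v∉S eq with cls-sound _ _ eq
  ... | inj₁ u≡v = u≡v
  ... | inj₂ uv  = ⊥-elim (resolving-meets-twins G resolving uv u∉S v∉S)

  -- Outside S the classes are singletons, so missing class i would leave at most 3 vertices outside S.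
  outsider : ∀ i → ∃[ v ] (v ∉ S × cls v ≡ i)
  outsider i with any? (λ v → ¬? (v ∈? S) ×-dec (cls v ≟ i))
  ... | yes found = found
  ... | no none   = ⊥-elim (<⇒≱ (n∸4+3<n 4≤n) (subst (λ k → n ≤ k + 3) ∣S∣≡ bound))
    where
    i≢cls : ∀ {v} → v ∉ S → i ≢ cls v
    i≢cls v∉S i≡cls = none (_ , v∉S , sym i≡cls)
    bound : n ≤ ∣ S ∣ + 3
    bound = ∣∁∣-injection⇒≤ S (λ v v∉S → punchOut (i≢cls v∉S)) λ u∉S v∉S eq →
      ∉S-cls-injective u∉S v∉S (punchOut-injective (i≢cls u∉S) (i≢cls v∉S) eq)

  r : Fin 4 → Fin n
  r i = proj₁ (outsider i)

  r∉S : ∀ i → r i ∉ S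
  r∉S i = proj₁ (proj₂ (outsider i))

  cls-r : ∀ i → cls (r i) ≡ i
  cls-r i = proj₂ (proj₂ (outsider i))

  r-injective : ∀ {i j} → r i ≡ r j → i ≡ j
  r-injective {i} {j} eq = trans (sym (cls-r i)) (trans (cong cls eq) (cls-r j))

  ∉S⇒≡r : ∀ {v} → v ∉ S → v ≡ r (cls v)
  ∉S⇒≡r v∉S = ∉S-cls-injective v∉S (r∉S _) (sym (cls-r _))

  r-twin : ∀ v → TwinOrEqual G v (r (cls v))
  r-twin v = cls-sound v _ (sym (cls-r _))

  HasS : Fin 4 → Set
  HasS i = ∃[ s ] (s ∈ S × cls s ≡ i)

  HasS? : ∀ i → Dec (HasS i)
  HasS? i = any? λ s → (s ∈? S) ×-dec (cls s ≟ i)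

  choose : Fin 4 → Fin n
  choose i with HasS? i
  ... | yes (s , _) = s
  ... | no _        = r i

  choose-∈S : ∀ {i} → HasS i → choose i ∈ S
  choose-∈S {i} has with HasS? i
  ... | yes (_ , s∈S , _) = s∈S
  ... | no  hasn't        = ⊥-elim (hasn't has)

  cls-choose : ∀ {i} → HasS i → cls (choose i) ≡ i
  cls-choose {i} has with HasS? i
  ... | yes (_ , _ , cls-s) = cls-s
  ... | no  hasn't          = ⊥-elim (hasn't has)

  ¬all-within2 : ¬ (∀ u v → Within2 G u v)
  ¬all-within2 within2 with proj₂ diam
  ... | u , v , D with Within2⇒IsDist≤2 G (within2 u v) D
  ... | s≤s (s≤s ())

  module Colouring (h : Fin 4 → Fin 4) (HasS-h : ∀ j → HasS (h j)) where

    g : Fin 4 → Fin n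
    g j = choose (h j)

    g∈S : ∀ j → g j ∈ S
    g∈S j = choose-∈S (HasS-h j)

    cls-g : ∀ j → cls (g j) ≡ h j
    cls-g j = cls-choose (HasS-h j)

    g≡⇒h≡ : ∀ {j k} → g j ≡ g k → h j ≡ h k
    g≡⇒h≡ {j} {k} eq = trans (sym (cls-g j)) (trans (cong cls eq) (cls-g k))

    g-cls-injective : ∀ {j k} → cls (g j) ≡ cls (g k) → g j ≡ g k
    g-cls-injective {j} {k} eq = cong choose (trans (sym (cls-g j)) (trans eq (cls-g k)))

    key : Fin n → Fin n
    key v with v ∈? S
    ... | yes _ = v
    ... | no  _ = g (cls v)

    key∈S : ∀ v → key v ∈ S
    key∈S v with v ∈? S
    ... | yes v∈S = v∈S
    ... | no  _   = g∈S (cls v)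

    key-∈ : ∀ {v} → v ∈ S → key v ≡ v
    key-∈ {v} v∈S with v ∈? S
    ... | yes _   = refl
    ... | no  v∉S = ⊥-elim (v∉S v∈S)

    key-∉ : ∀ {v} → v ∉ S → key v ≡ g (cls v)
    key-∉ {v} v∉S with v ∈? S
    ... | yes v∈S = ⊥-elim (v∉S v∈S)
    ... | no  _   = refl

    -- Vertices of S get pairwise distinct colours, and r j borrows the colour of g j.
    colour : Fin n → Fin ∣ S ∣
    colour v = index S (key∈S v)

    module KeyPreserving (π : Permutation′ n) (aut : IsAutomorphism G π)
                         (preserves : ∀ v → key (π ⟨$⟩ʳ v) ≡ key v) where
      open Automorphism G π aut

      key-π-r : ∀ z → key (π ⟨$⟩ʳ r z) ≡ g z
      key-π-r z = trans (preserves _) (trans (key-∉ (r∉S z)) (cong g (cls-r z)))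

      module _ {s} (s∈S : s ∈ S) (moved : π ⟨$⟩ʳ s ≢ s) where

        moved-∉S : π ⟨$⟩ʳ s ∉ S
        moved-∉S πs∈S = moved (trans (sym (key-∈ πs∈S)) (trans (preserves s) (key-∈ s∈S)))

        moved-key : g (cls (π ⟨$⟩ʳ s)) ≡ s
        moved-key = trans (sym (key-∉ moved-∉S)) (trans (preserves s) (key-∈ s∈S))

        private
          cls-π-twin : cls (π ⟨$⟩ʳ s) ≡ cls (π ⟨$⟩ʳ r (cls s))
          cls-π-twin = cls-complete _ _ (TwinOrEqual-map (r-twin s))

        -- π maps the twin r (cls s) of s to a twin of π s; outside S it would have to be π s itself.
        partner-image : π ⟨$⟩ʳ r (cls s) ≡ g (cls s)
        partner-image with π ⟨$⟩ʳ r (cls s) ∈? S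
        ... | yes image∈S = trans (sym (key-∈ image∈S)) (key-π-r (cls s))
        ... | no  image∉S = ⊥-elim (r∉S (cls s) (subst (_∈ S) (sym (injective same-image)) s∈S))
          where
          same-image : π ⟨$⟩ʳ r (cls s) ≡ π ⟨$⟩ʳ s
          same-image = trans (∉S⇒≡r image∉S) (trans (cong r (sym cls-π-twin)) (sym (∉S⇒≡r moved-∉S)))

        h-cls : h (cls s) ≡ cls (π ⟨$⟩ʳ s)
        h-cls = trans (sym (cls-g _)) (trans (cong cls (sym partner-image)) (sym cls-π-twin))

        moved-image : π ⟨$⟩ʳ s ≡ r (h (cls s))
        moved-image = trans (∉S⇒≡r moved-∉S) (cong r (sym h-cls))

        moved-2-cycle : h (h (cls s)) ≡ cls s
        moved-2-cycle = trans (cong h h-cls) (trans (sym (cls-g _)) (cong cls moved-key))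

        partner-moved : π ⟨$⟩ʳ g (cls s) ≢ g (cls s)
        partner-moved fixed =
          r∉S (cls s) (subst (_∈ S) (sym (injective (trans partner-image (sym fixed)))) (g∈S _))

    Rigid : Set
    Rigid = ∀ π → IsAutomorphism G π → (∀ v → key (π ⟨$⟩ʳ v) ≡ key v) →
            ∀ {s} → s ∈ S → π ⟨$⟩ʳ s ≢ s → ⊥

    rigid⇒distinguishing : Rigid → Distinguishing G ∣ S ∣ colour
    rigid⇒distinguishing rigid π aut preserves =
      Automorphism.fixing-resolving⇒identity G π aut resolving fixes
      where
      fixes : ∀ s → s ∈ S → π ⟨$⟩ʳ s ≡ s
      fixes s s∈S with π ⟨$⟩ʳ s ≟ s
      ... | yes fixed = fixed
      ... | no  moved = ⊥-elim (rigid π aut (λ v → index-injective S _ _ (preserves v)) s∈S moved)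

    no-2-cycle⇒rigid : (∀ j → h (h j) ≢ j) → Rigid
    no-2-cycle⇒rigid no-2-cycle π aut preserves s∈S moved =
      no-2-cycle _ (KeyPreserving.moved-2-cycle π aut preserves s∈S moved)

    module Swap (a b x y : Fin 4) (complement : Complement a b x y)
                (h-a : h a ≡ b) (h-b : h b ≡ a) (h-x≢h-y : h x ≢ h y)
                (S⊆ab : ∀ {s} → s ∈ S → cls s ≡ a ⊎ cls s ≡ b) where
      open Complement complement

      InPair : Fin n → Set
      InPair v = cls v ≡ a ⊎ cls v ≡ b

      r∉pair : ∀ {z} → z ≢ a → z ≢ b → ¬ InPair (r z)
      r∉pair {z} z≢a z≢b = [ z≢a ∘ trans (sym (cls-r z)) , z≢b ∘ trans (sym (cls-r z)) ]′

      h-injective-off-pair : ∀ {j k} → j ≢ a → j ≢ b → k ≢ a → k ≢ b → h j ≡ h k → j ≡ k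
      h-injective-off-pair {j} {k} j≢a j≢b k≢a k≢b eq with off-pair j≢a j≢b | off-pair k≢a k≢b
        where
        off-pair : ∀ {j} → j ≢ a → j ≢ b → j ≡ x ⊎ j ≡ y
        off-pair {j} j≢a j≢b with cover j
        ... | inj₁ j≡a         = ⊥-elim (j≢a j≡a)
        ... | inj₂ (inj₁ j≡b)  = ⊥-elim (j≢b j≡b)
        ... | inj₂ (inj₂ j∈xy) = j∈xy
      ... | inj₁ refl | inj₁ refl = refl
      ... | inj₁ refl | inj₂ refl = ⊥-elim (h-x≢h-y eq)
      ... | inj₂ refl | inj₁ refl = ⊥-elim (h-x≢h-y (sym eq))
      ... | inj₂ refl | inj₂ refl = refl

      g-in-pair : ∀ j → g j ≡ g a ⊎ g j ≡ g b
      g-in-pair j with S⊆ab (g∈S j)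
      ... | inj₁ cls≡a = inj₂ (g-cls-injective (trans cls≡a (sym (trans (cls-g b) h-b))))
      ... | inj₂ cls≡b = inj₁ (g-cls-injective (trans cls≡b (sym (trans (cls-g a) h-a))))

      module _ (π : Permutation′ n) (aut : IsAutomorphism G π)
               (preserves : ∀ v → key (π ⟨$⟩ʳ v) ≡ key v) where
        open Automorphism G π aut
        open KeyPreserving π aut preserves

        -- A moved vertex of S in class a makes π swap r j with g j for both j ∈ {a, b},
        -- and fix r x and r y; then {v | InPair v} is a module of G and the diameter drops to 2.
        module _ {s} (s∈S : s ∈ S) (cls-s : cls s ≡ a) (moved : π ⟨$⟩ʳ s ≢ s) where
          private
            cls-πs : cls (π ⟨$⟩ʳ s) ≡ b
            cls-πs = trans (sym (h-cls s∈S moved)) (trans (cong h cls-s) h-a)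

            g-b : g b ≡ s
            g-b = trans (cong g (sym cls-πs)) (moved-key s∈S moved)

            ga-moved : π ⟨$⟩ʳ g a ≢ g a
            ga-moved = subst (λ j → π ⟨$⟩ʳ g j ≢ g j) cls-s (partner-moved s∈S moved)

            cls-ga : cls (g a) ≡ b
            cls-ga = trans (cls-g a) h-a

          swap : ∀ {j} → j ≡ a ⊎ j ≡ b → π ⟨$⟩ʳ r j ≡ g j × π ⟨$⟩ʳ g j ≡ r j
          swap (inj₁ refl) =
            subst (λ j → π ⟨$⟩ʳ r j ≡ g j) cls-s (partner-image s∈S moved) ,
            trans (moved-image (g∈S a) ga-moved) (cong r (trans (cong h cls-ga) h-b))
          swap (inj₂ refl) =
            subst (λ j → π ⟨$⟩ʳ r j ≡ g j) cls-ga (partner-image (g∈S a) ga-moved) ,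
            trans (cong (π ⟨$⟩ʳ_) g-b) (trans (∉S⇒≡r (moved-∉S s∈S moved)) (cong r cls-πs))

          private
            not-onto-pair : ∀ {z j} → j ≡ a ⊎ j ≡ b → π ⟨$⟩ʳ r z ≢ r j
            not-onto-pair {z} {j} j∈ab eq =
              r∉S z (subst (_∈ S) (sym (injective (trans eq (sym (proj₂ (swap j∈ab)))))) (g∈S j))

            not-onto-g-pair : ∀ {z j} → j ≡ a ⊎ j ≡ b → z ≢ j → π ⟨$⟩ʳ r z ≢ g j
            not-onto-g-pair j∈ab z≢j eq = z≢j (r-injective (injective (trans eq (sym (proj₁ (swap j∈ab))))))

          outsider-fixed : ∀ {z} → z ≢ a → z ≢ b → π ⟨$⟩ʳ r z ≡ r z
          outsider-fixed {z} z≢a z≢b with π ⟨$⟩ʳ r z ∈? S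
          ... | yes image∈S = ⊥-elim ([ not-onto-g-pair (inj₁ refl) z≢a ∘ trans π-rz
                                      , not-onto-g-pair (inj₂ refl) z≢b ∘ trans π-rz ]′ (g-in-pair z))
            where
            π-rz : π ⟨$⟩ʳ r z ≡ g z
            π-rz = trans (sym (key-∈ image∈S)) (key-π-r z)
          ... | no image∉S with cls (π ⟨$⟩ʳ r z) ≟ a | cls (π ⟨$⟩ʳ r z) ≟ b
          ... | yes j≡a | _       = ⊥-elim (not-onto-pair (inj₁ j≡a) (∉S⇒≡r image∉S))
          ... | no _    | yes j≡b = ⊥-elim (not-onto-pair (inj₂ j≡b) (∉S⇒≡r image∉S))
          ... | no j≢a  | no j≢b  = trans (∉S⇒≡r image∉S) (cong r (h-injective-off-pair j≢a j≢b z≢a z≢b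
                                      (g≡⇒h≡ (trans (sym (key-∉ image∉S)) (key-π-r z)))))

          adj-from-outsider : ∀ {z u} → z ≢ a → z ≢ b → InPair u → adj G (r z) u ≡ adj G (r z) (g b)
          adj-from-outsider {z} {u} z≢a z≢b (inj₁ cls-u) =
            twin-or-equal-adj G (cls-sound u (g b) (trans cls-u (sym (trans (cls-g b) h-b))))
              (λ eq → r∉pair z≢a z≢b (inj₁ (trans (cong cls eq) cls-u)))
              (λ eq → r∉S z (subst (_∈ S) (sym eq) (g∈S b)))
          adj-from-outsider {z} {u} z≢a z≢b (inj₂ cls-u) = begin
            adj G (r z) u                   ≡⟨ twin-or-equal-adj G twin rz≢u (z≢b ∘ r-injective) ⟩
            adj G (r z) (r b)               ≡⟨ cong₂ (adj G) (outsider-fixed z≢a z≢b) (proj₂ (swap (inj₂ refl))) ⟨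
            adj G (π ⟨$⟩ʳ r z) (π ⟨$⟩ʳ g b) ≡⟨ aut (r z) (g b) ⟩
            adj G (r z) (g b)               ∎
            where
            open ≡-Reasoning
            twin : TwinOrEqual G u (r b)
            twin = cls-sound u (r b) (trans cls-u (sym (cls-r b)))
            rz≢u : r z ≢ u
            rz≢u eq = r∉pair z≢a z≢b (inj₂ (trans (cong cls eq) cls-u))

          within2 : ∀ u v → Within2 G u v
          within2 = module-with-two-outside-within2 G conn InPair (inj₁ (trans (cls-g b) h-b))
            (r x) (r y) (λ eq → x≢y (r-injective eq)) (r∉pair x≢a x≢b) (r∉pair y≢a y≢b) cover′
            (homogeneous x≢a x≢b) (homogeneous y≢a y≢b)
            where
            homogeneous : ∀ {z} → z ≢ a → z ≢ b → HomogeneousTo G InPair (r z)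
            homogeneous z≢a z≢b u∈ v∈ =
              trans (adj-from-outsider z≢a z≢b u∈) (sym (adj-from-outsider z≢a z≢b v∈))
            outside-pair : ∀ {v} → cls v ≡ x ⊎ cls v ≡ y → v ∉ S
            outside-pair (inj₁ refl) v∈S = [ x≢a , x≢b ]′ (S⊆ab v∈S)
            outside-pair (inj₂ refl) v∈S = [ y≢a , y≢b ]′ (S⊆ab v∈S)
            cover′ : ∀ v → InPair v ⊎ v ≡ r x ⊎ v ≡ r y
            cover′ v with cover (cls v)
            ... | inj₁ cls-v               = inj₁ (inj₁ cls-v)
            ... | inj₂ (inj₁ cls-v)        = inj₁ (inj₂ cls-v)
            ... | inj₂ (inj₂ (inj₁ cls-v)) =
              inj₂ (inj₁ (trans (∉S⇒≡r (outside-pair (inj₁ cls-v))) (cong r cls-v)))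
            ... | inj₂ (inj₂ (inj₂ cls-v)) =
              inj₂ (inj₂ (trans (∉S⇒≡r (outside-pair (inj₂ cls-v))) (cong r cls-v)))

      swap-rigid : Rigid
      swap-rigid π aut preserves s∈S moved with S⊆ab s∈S
      ... | inj₁ cls-s = ¬all-within2 (within2 π aut preserves s∈S cls-s moved)
      ... | inj₂ cls-s = ¬all-within2 (within2 π aut preserves (g∈S _)
                           (trans (cls-g _) (trans (cong h cls-s) h-b))
                           (KeyPreserving.partner-moved π aut preserves s∈S moved))

  dist : Fin n → Fin n → ℕ
  dist u v = proj₁ (proj₁ diam u v)

  IsDist-dist : ∀ u v → IsDist G u v (dist u v)
  IsDist-dist u v = proj₁ (proj₂ (proj₁ diam u v))

  dist≤3 : ∀ u v → dist u v ≤ 3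
  dist≤3 u v = proj₂ (proj₂ (proj₁ diam u v))

  -- All vertices of S are then twins of s₀, so S cannot separate the four vertices r i,
  -- whose distances from s₀ lie in {1, 2, 3}.
  single-class-impossible : ∀ {s₀} → s₀ ∈ S → ¬ (∀ {s} → s ∈ S → cls s ≡ cls s₀)
  single-class-impossible {s₀} s₀∈S same =
    let i , j , i≢j , eq = pigeonhole-positive ≤-refl (λ i → dist s₀ (r i))
                             (λ i → IsDist-nonzero G (IsDist-dist _ _) (∈-∉-distinct s₀∈S (r∉S i)))
                             (λ i → dist≤3 _ _)
        s , s∈S , _ , _ , D₁ , D₂ , d₁≢d₂ = resolving (r i) (r j) (λ eq → i≢j (r-injective eq))
    in d₁≢d₂ (trans (via-s₀ s∈S D₁) (trans eq (sym (via-s₀ s∈S D₂))))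
    where
    via-s₀ : ∀ {s k e} → s ∈ S → IsDist G s (r k) e → e ≡ dist s₀ (r k)
    via-s₀ {k = k} s∈S Ds = twin-or-equal-equidistant G (cls-sound _ _ (same s∈S))
      (∈-∉-distinct s∈S (r∉S k) ∘ sym) (∈-∉-distinct s₀∈S (r∉S k) ∘ sym) Ds (IsDist-dist _ _)

  three-classes : ∀ {s₀ s₁ s₂} → s₀ ∈ S → s₁ ∈ S → s₂ ∈ S →
                  cls s₁ ≢ cls s₀ → cls s₂ ≢ cls s₀ → cls s₂ ≢ cls s₁ →
                  ∃[ c ] Distinguishing G ∣ S ∣ c
  three-classes {s₀} {s₁} {s₂} s₀∈S s₁∈S s₂∈S b≢a c≢a c≢b =
    colour , rigid⇒distinguishing (no-2-cycle⇒rigid (twoPoint-no-2-cycle b≢a c≢a c≢b))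
    where
    open TwoPoint (cls s₀) (cls s₁) (cls s₁) (cls s₂)
    open Colouring twoPoint (closed HasS (s₀ , s₀∈S , refl) (s₁ , s₁∈S , refl) (s₂ , s₂∈S , refl))

  -- With a = cls s₀ and b = cls s₁, h sends a, y ↦ b and b, x ↦ a; its one 2-cycle (a b) is handled by Swap.
  two-classes : ∀ {s₀ s₁} → s₀ ∈ S → s₁ ∈ S → cls s₁ ≢ cls s₀ →
                (∀ {s} → s ∈ S → cls s ≡ cls s₀ ⊎ cls s ≡ cls s₁) →
                ∃[ c ] Distinguishing G ∣ S ∣ c
  two-classes {s₀} {s₁} s₀∈S s₁∈S b≢a S⊆ab with x , y , complement ← complete-pair (b≢a ∘ sym) =
    colour , rigid⇒distinguishing (swap-rigid (cls s₀) (cls s₁) x y complement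
      at-a (elsewhere b≢a (y≢b ∘ sym))
      (λ hx≡hy → b≢a (trans (sym (at-p y≢a)) (trans (sym hx≡hy) (elsewhere x≢a x≢y))))
      S⊆ab)
    where
    open Complement complement
    open TwoPoint (cls s₀) (cls s₁) y (cls s₁)
    open Colouring twoPoint (closed HasS (s₀ , s₀∈S , refl) (s₁ , s₁∈S , refl) (s₁ , s₁∈S , refl))
    open Swap

  small-distinguishing-colouring : ∃[ c ] Distinguishing G ∣ S ∣ c
  small-distinguishing-colouring
    with s₀ , s₀∈S , _ ← resolving (r 0F) (r 1F) (0≢1+n ∘ r-injective)
    with any? (λ s → (s ∈? S) ×-dec ¬? (cls s ≟ cls s₀))
  ... | no single-class = ⊥-elim (single-class-impossible s₀∈S λ {s} s∈S →
                             decidable-stable (cls s ≟ cls s₀) λ ≢ → single-class (s , s∈S , ≢))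
  ... | yes (s₁ , s₁∈S , b≢a)
    with any? (λ s → (s ∈? S) ×-dec (¬? (cls s ≟ cls s₀) ×-dec ¬? (cls s ≟ cls s₁)))
  ...   | yes (s₂ , s₂∈S , c≢a , c≢b) = three-classes s₀∈S s₁∈S s₂∈S b≢a c≢a c≢b
  ...   | no  no-third = two-classes s₀∈S s₁∈S b≢a S⊆ab
    where
    S⊆ab : ∀ {s} → s ∈ S → cls s ≡ cls s₀ ⊎ cls s ≡ cls s₁
    S⊆ab {s} s∈S with cls s ≟ cls s₀ | cls s ≟ cls s₁
    ... | yes ≡a | _      = inj₁ ≡a
    ... | no  _  | yes ≡b = inj₂ ≡b
    ... | no  ≢a | no  ≢b = ⊥-elim (no-third (s , s∈S , ≢a , ≢b))

mainTheorem12 : (n : ℕ) (G : Graph n) → Connected G →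
    HasMetricDim G (n ∸ 4) → HasDiameter G 3 → TwinClassCount G 4 →
    ¬ HasDistNum G (n ∸ 3)
mainTheorem12 n G conn ((S , resolving , ∣S∣≡) , _) diam (cls , sound , complete , onto) (_ , minimal)
  = <⇒≱ (n∸4<n∸3 4≤n)
        (subst (n ∸ 3 ≤_) ∣S∣≡ (uncurry (minimal ∣ S ∣) small-distinguishing-colouring))
  where open Hypotheses G conn diam resolving ∣S∣≡ cls sound complete onto
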